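{- Let $X=\{a_1,\dots,a_n\}$, let $\mathcal{F}$ be a union-closed family of subsets of $X$ with $\bigcup_{f\in\mathcal{F}}f=X$, let $w=a_1\cdots a_n$, and let $S\subseteq\mathcal{F}$ be an antichain. Then $$\sum_{f\in\mathcal{F}[S]}|f|\ \ge\ \frac{n}{2}|\mathcal{F}[S]|+\frac12\sum_{a\in X}\Big(|\pi_w(a)\cap S^{\uparrow}|-|\sigma_w(a)\cap S^{\uparrow}|\Big),$$ with equality if $S=\min(\mathcal{F})$.
   Context: Union-closed: $f,g\in\mathcal{F}\Rightarrow f\cup g\in\mathcal{F}$. An antichain is a non-empty family of pairwise incomparable sets; $\min(\mathcal{F})$ is the set of inclusion-minimal members. $\mathcal{F}[S]=\{f\in\mathcal{F}:\exists z\in S,\ z\subseteq f\}$, $S^{\uparrow}=\{g\subseteq X:\exists z\in S,\ z\subseteq g\}$, $\mathcal{F}_a=\{f\in\mathcal{F}:a\in f\}$. Rising functions: for $T\subseteq 2^X$, $a\in X$, $\varphi_{T,a}(z)=z\cup\{a\}$ if $z\cup\{a\}\notin T$ and $z$ otherwise; with $\varphi_0=\mathrm{id}$, $\mathcal{F}_0=\mathcal{F}$, $\varphi_j=\varphi_{\mathcal{F}_{j-1},a_j}\circ\varphi_{j-1}$, $\mathcal{F}_j=\varphi_j(\mathcal{F})$, set $\varphi_w=\varphi_n$ (injective on $\mathcal{F}$). Pure elements: $\pi_w(a)=\{\eta\in\varphi_w(\mathcal{F}_a):\eta\setminus\{a\}\notin\varphi_w(\mathcal{F})\}$. Spurious elements: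 $\sigma_w(a)=\{\eta\in\varphi_w(\mathcal{F}): a\in\eta\setminus\varphi_w^{ -1}(\eta)\}$. -}

module Defs where

open import Data.Bool using (Bool; true; false; not; _∧_; if_then_else_)
open import Data.Nat using (ℕ; zero; suc)
import Data.Nat as N
open import Data.Integer using (ℤ; +_; _-_) renaming (_+_ to _+ℤ_)
open import Data.List using (List; []; _∷_; map; filter; length; foldr; allFin)
open import Data.Bool.ListAction using (any)
import Data.Bool as B
open import Data.Vec using (_∷_; []; _[_]≔_)
open import Data.Vec.Properties using (≡-dec)
open import Data.Fin using (Fin)
open import Data.Fin.Subset using (Subset; inside; outside; _∈_; _⊆_; _∪_; ∣_∣; ⁅_⁆)
open import Data.Fin.Subset.Properties using (_⊆?_; _⊂?_)
open import Data.Product using (Σ; _×_; ∃)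
open import Relation.Nullary using (does)
open import Relation.Binary.PropositionalEquality using (_≡_)
open import Function using (id; _∘_)

allSubsets : (n : ℕ) → List (Subset n)
allSubsets zero = [] ∷ []
allSubsets (suc n) = map (outside ∷_) (allSubsets n) Data.List.++ map (inside ∷_) (allSubsets n)
  where import Data.List

_≡ˢ_ : {n : ℕ} → Subset n → Subset n → Bool
p ≡ˢ q = does (≡-dec B._≟_ p q)

_⊆ᵇ_ : {n : ℕ} → Subset n → Subset n → Bool
p ⊆ᵇ q = does (p ⊆? q)

_⊂ᵇ_ : {n : ℕ} → Subset n → Subset n → Bool
p ⊂ᵇ q = does (p ⊂? q)

_∈ᵇ_ : {n : ℕ} → Fin n → Subset n → Bool
a ∈ᵇ p = does (⁅ a ⁆ ⊆? p)

Fam : ℕ → Set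
Fam n = Subset n → Bool

card : {n : ℕ} → Fam n → ℕ
card {n} F = length (filter (λ z → F z B.≟ true) (allSubsets n))

sumOver : {n : ℕ} → Fam n → (Subset n → ℕ) → ℕ
sumOver {n} F w = foldr (λ z acc → (if F z then w z else 0) N.+ acc) 0 (allSubsets n)

_∩ᶠ_ : {n : ℕ} → Fam n → Fam n → Fam n
(F ∩ᶠ G) z = F z ∧ G z

image : {n : ℕ} → (Subset n → Subset n) → Fam n → Fam n
image {n} φ F η = any (λ z → F z ∧ (φ z ≡ˢ η)) (allSubsets n)

UnionClosed : {n : ℕ} → Fam n → Set
UnionClosed F = ∀ f g → F f ≡ true → F g ≡ true → F (f ∪ g) ≡ true

CoversX : {n : ℕ} → Fam n → Set
CoversX {n} F = ∀ (x : Fin n) → ∃ λ f → F f ≡ true × x ∈ f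

SubFamily : {n : ℕ} → Fam n → Fam n → Set
SubFamily S F = ∀ s → S s ≡ true → F s ≡ true

Antichain : {n : ℕ} → Fam n → Set
Antichain S = (∃ λ s → S s ≡ true) × (∀ s t → S s ≡ true → S t ≡ true → s ⊆ t → s ≡ t)

minFam : {n : ℕ} → Fam n → Fam n
minFam {n} F f = F f ∧ not (any (λ g → F g ∧ (g ⊂ᵇ f)) (allSubsets n))

restrictTo : {n : ℕ} → Fam n → Fam n → Fam n
restrictTo {n} F S f = F f ∧ any (λ z → S z ∧ (z ⊆ᵇ f)) (allSubsets n)

upset : {n : ℕ} → Fam n → Fam n
upset {n} S g = any (λ z → S z ∧ (z ⊆ᵇ g)) (allSubsets n)

withElem : {n : ℕ} → Fam n → Fin n → Fam n
withElem F a f = F f ∧ (a ∈ᵇ f)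

rise : {n : ℕ} → Fam n → Fin n → Subset n → Subset n
rise T a z = if T (z [ a ]≔ inside) then z else z [ a ]≔ inside

-- Given φ_{j-1}, apply the remaining letters: φ_j = φ_{F_{j-1},a_j} ∘ φ_{j-1}, F_{j-1} = φ_{j-1}(F)
risingFrom : {n : ℕ} → Fam n → (Subset n → Subset n) → List (Fin n) → Subset n → Subset n
risingFrom F φ [] = φ
risingFrom F φ (a ∷ as) = risingFrom F (rise (image φ F) a ∘ φ) as

-- φ_w for w = a_1 ⋯ a_n, where a_j is the j-th element of Fin n
φw : {n : ℕ} → Fam n → Subset n → Subset n
φw {n} F = risingFrom F id (allFin n)

pure : {n : ℕ} → Fam n → Fin n → Fam n
pure F a η = image (φw F) (withElem F a) η ∧ not (image (φw F) F (η [ a ]≔ outside))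

spurious : {n : ℕ} → Fam n → Fin n → Fam n
spurious {n} F a η = (a ∈ᵇ η) ∧ any (λ f → F f ∧ (φw F f ≡ˢ η) ∧ not (a ∈ᵇ f)) (allSubsets n)

sumℤ : List ℤ → ℤ
sumℤ = foldr _+ℤ_ (+ 0)

pureSpuriousSum : {n : ℕ} → Fam n → Fam n → ℤ
pureSpuriousSum {n} F S =
  sumℤ (map (λ a → + card (pure F a ∩ᶠ upset S) - + card (spurious F a ∩ᶠ upset S)) (allFin n))

-- Applying the letters one at a time preserves an
-- invariant (RisingInvariant): sets only rise, a member of F lying below φ f already
-- lies below f, and the image family φ(F) is closed under adding processed letters
-- and absorbs members of F.  It holds initially because F is union-closed.  At the
-- end φ is injective on F, φ(F) is an up-set, spurious elements cannot be removed
-- inside φ(F), and φ does not change membership in S↑ (RisingFacts).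
--
-- Part 2, counting one letter a at a time over the members z of F[S] (Counting).
-- Pointwise  1 + [z pure] + [a ∈ z, φ z ∖ a ∈ φ(F)] = 2[a ∈ z] + [a spurious] + [a ∉ φ z];
-- the up-set φ(F[S]) has as many members avoiding a as members η ∋ a with
-- η ∖ a ∈ φ(F[S]) (shift-count), and for those a ∈ z.  Hence
--   |F[S]| + |π_w(a) ∩ S↑| ≤ 2|{f ∈ F[S] : a ∈ f}| + |σ_w(a) ∩ S↑|,
-- with equality once every member of F lies in S↑, as it does for S = min(F).
-- Summing over a and passing to ℤ gives the theorem.

module Submission where

open import Defs
open import Data.Nat using (ℕ; _*_)
open import Data.Integer using (ℤ; +_; _≤_; _+_)
open import Data.Fin.Subset using (Subset)
open import Data.Product using (_×_)
open import Relation.Binary.PropositionalEquality using (_≡_)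

open import Data.Bool using (Bool; true; false; not; _∧_; _∨_; if_then_else_)
import Data.Bool.Properties as BoolP
open import Algebra.Bundles using (CommutativeMonoid)
import Algebra.Properties.CommutativeSemigroup as CommSemigroupProps
import Data.Nat as N
import Data.Nat.Properties as NP
open import Algebra.Properties.CommutativeSemigroup NP.+-commutativeSemigroup using () renaming (interchange to +-interchange)
open import Data.Fin as Fin using (Fin)
open import Data.Fin.Subset as FS using (_∈_; _∉_; _⊆_; _∪_)
import Data.Fin.Subset.Properties as FSP
open import Data.Vec using (_∷_; []; lookup; _[_]≔_)
import Data.Vec.Properties as VP
open import Data.List as L using (List; []; _∷_; _++_; allFin)
import Data.List.Properties as LP
open import Data.List.Membership.Propositional using () renaming (_∈_ to _∈ˡ_)
open import Data.List.Membership.Propositional.Properties using (∈-allFin; ∈-++⁺ˡ; ∈-++⁺ʳ; ∈-map⁺)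
open import Data.List.Relation.Unary.Any using (here; there; satisfied)
open import Data.List.Relation.Unary.Any.Properties using (any⁺; any⁻)
open import Data.List.Membership.Propositional using (lose)
open import Data.Bool.ListAction using (any)
open import Data.Product using (∃; _,_)
open import Data.Sum using (_⊎_; inj₁; inj₂)
open import Data.Empty using (⊥-elim)
open import Relation.Nullary using (Dec; yes; no; does; ¬_)
open import Relation.Nullary.Decidable using (dec-true)
open import Relation.Binary.PropositionalEquality using (refl; sym; trans; cong; cong₂; subst; subst₂; _≢_; module ≡-Reasoning)
open import Function using (id; _∘_; Equivalence)
open import Data.Integer using (_-_)
import Data.Integer.Properties as ℤP
open import Data.Integer.Tactic.RingSolver using (solve-∀)
open import Data.Fin.Subset.Induction using (⊂-wellFounded; Acc; acc)

does-true : ∀ {p} {P : Set p} (d : Dec P) → does d ≡ true → P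
does-true (yes p) _ = p

∧-trueˡ : ∀ {a b} → a ∧ b ≡ true → a ≡ true
∧-trueˡ {true} _ = refl

∧-trueʳ : ∀ {a b} → a ∧ b ≡ true → b ≡ true
∧-trueʳ {true} e = e

∧-true⁺ : ∀ {a b} → a ≡ true → b ≡ true → a ∧ b ≡ true
∧-true⁺ refl refl = refl

module ∧-Props = CommSemigroupProps (CommutativeMonoid.commutativeSemigroup BoolP.∧-commutativeMonoid)

bool-ext : ∀ {a b : Bool} → (a ≡ true → b ≡ true) → (b ≡ true → a ≡ true) → a ≡ b
bool-ext {true}  {true}  _ _ = refl
bool-ext {true}  {false} f _ = sym (f refl)
bool-ext {false} {true}  _ g = g refl
bool-ext {false} {false} _ _ = refl

module _ {n : ℕ} where

  add del : Subset n → Fin n → Subset n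
  add z a = z [ a ]≔ true
  del z a = z [ a ]≔ false

  ∈⇒lookup : ∀ {i} {z : Subset n} → i ∈ z → lookup z i ≡ true
  ∈⇒lookup = VP.[]=⇒lookup

  lookup⇒∈ : ∀ {i} {z : Subset n} → lookup z i ≡ true → i ∈ z
  lookup⇒∈ {i} {z} = VP.lookup⇒[]= i z

  ∈-add-self : ∀ (z : Subset n) a → a ∈ add z a
  ∈-add-self z a = VP.[]≔-updates z a

  ⊆-add : ∀ {z : Subset n} {a} → z ⊆ add z a
  ⊆-add {z} {a} {i} i∈z with i Fin.≟ a
  ... | yes refl = ∈-add-self z a
  ... | no i≢a = VP.[]≔-minimal z i a i≢a i∈z

  ∈-add⁻ : ∀ {z : Subset n} {a i} → i ∈ add z a → i ≡ a ⊎ i ∈ z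
  ∈-add⁻ {z} {a} {i} i∈ with i Fin.≟ a
  ... | yes i≡a = inj₁ i≡a
  ... | no i≢a = inj₂ (lookup⇒∈ (trans (sym (VP.lookup∘update′ i≢a z true)) (∈⇒lookup i∈)))

  ∉-del-self : ∀ (z : Subset n) a → a ∉ del z a
  ∉-del-self z a a∈ with () ← trans (sym (VP.lookup∘update a z false)) (∈⇒lookup a∈)

  ∈-del⁺ : ∀ {z : Subset n} {a i} → i ∈ z → i ≢ a → i ∈ del z a
  ∈-del⁺ {z} {a} {i} i∈z i≢a = VP.[]≔-minimal z i a i≢a i∈z

  del-⊆ : ∀ {z : Subset n} {a} → del z a ⊆ z
  del-⊆ {z} {a} {i} i∈ with i Fin.≟ a
  ... | yes refl = ⊥-elim (∉-del-self z a i∈)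
  ... | no i≢a = lookup⇒∈ (trans (sym (VP.lookup∘update′ i≢a z false)) (∈⇒lookup i∈))

  add-idem : ∀ (z : Subset n) a → add (add z a) a ≡ add z a
  add-idem z a = VP.[]≔-idempotent z a

  add-comm : ∀ (z : Subset n) {a b} → a ≢ b → add (add z a) b ≡ add (add z b) a
  add-comm z {a} {b} a≢b = VP.[]≔-commutes z a b a≢b

  add-∪ : ∀ (y s : Subset n) a → add (y ∪ s) a ≡ add y a ∪ s
  add-∪ y s a = FSP.⊆-antisym ⊆₁ ⊆₂
    where
    ⊆₁ : add (y ∪ s) a ⊆ add y a ∪ s
    ⊆₁ i∈ with ∈-add⁻ i∈
    ... | inj₁ refl = FSP.p⊆p∪q s (∈-add-self y a)
    ... | inj₂ i∈y∪s with FSP.x∈p∪q⁻ y s i∈y∪s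
    ...   | inj₁ i∈y = FSP.p⊆p∪q s (⊆-add i∈y)
    ...   | inj₂ i∈s = FSP.q⊆p∪q (add y a) s i∈s
    ⊆₂ : add y a ∪ s ⊆ add (y ∪ s) a
    ⊆₂ i∈ with FSP.x∈p∪q⁻ (add y a) s i∈
    ... | inj₂ i∈s = ⊆-add (FSP.q⊆p∪q y s i∈s)
    ... | inj₁ i∈ya with ∈-add⁻ i∈ya
    ...   | inj₁ refl = ∈-add-self (y ∪ s) a
    ...   | inj₂ i∈y = ⊆-add (FSP.p⊆p∪q s i∈y)

  ∪-fills-add : ∀ (y s : Subset n) a → s ⊆ add y a → a ∈ s → y ∪ s ≡ add y a
  ∪-fills-add y s a s⊆ a∈s = FSP.⊆-antisym ⊆₁ ⊆₂
    where
    ⊆₁ : y ∪ s ⊆ add y a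
    ⊆₁ i∈ with FSP.x∈p∪q⁻ y s i∈
    ... | inj₁ i∈y = ⊆-add i∈y
    ... | inj₂ i∈s = s⊆ i∈s
    ⊆₂ : add y a ⊆ y ∪ s
    ⊆₂ i∈ with ∈-add⁻ i∈
    ... | inj₁ refl = FSP.q⊆p∪q y s a∈s
    ... | inj₂ i∈y = FSP.p⊆p∪q s i∈y

  add-del : ∀ (z : Subset n) a → a ∈ z → add (del z a) a ≡ z
  add-del z a a∈z = FSP.⊆-antisym ⊆₁ ⊆₂
    where
    ⊆₁ : add (del z a) a ⊆ z
    ⊆₁ i∈ with ∈-add⁻ i∈
    ... | inj₁ refl = a∈z
    ... | inj₂ i∈ = del-⊆ i∈
    ⊆₂ : z ⊆ add (del z a) a
    ⊆₂ {i} i∈ with i Fin.≟ a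
    ... | yes refl = ∈-add-self (del z a) a
    ... | no i≢a = ⊆-add (∈-del⁺ i∈ i≢a)

  del-add : ∀ (z : Subset n) a → a ∉ z → del (add z a) a ≡ z
  del-add z a a∉z = FSP.⊆-antisym ⊆₁ ⊆₂
    where
    ⊆₁ : del (add z a) a ⊆ z
    ⊆₁ {i} i∈ with ∈-add⁻ (del-⊆ i∈)
    ... | inj₁ refl = ⊥-elim (∉-del-self (add z a) a i∈)
    ... | inj₂ i∈z = i∈z
    ⊆₂ : z ⊆ del (add z a) a
    ⊆₂ {i} i∈ = ∈-del⁺ (⊆-add i∈) λ { refl → a∉z i∈ }

  ∈ᵇ⇒∈ : ∀ {a} {z : Subset n} → (a ∈ᵇ z) ≡ true → a ∈ z
  ∈ᵇ⇒∈ {a} {z} e = does-true (FS.⁅ a ⁆ FSP.⊆? z) e (FSP.x∈⁅x⁆ a)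

  ∈⇒∈ᵇ : ∀ {a} {z : Subset n} → a ∈ z → (a ∈ᵇ z) ≡ true
  ∈⇒∈ᵇ {a} {z} a∈z = dec-true (FS.⁅ a ⁆ FSP.⊆? z) λ i∈ → subst (_∈ z) (sym (FSP.x∈⁅y⁆⇒x≡y a i∈)) a∈z

  ∉⇒∈ᵇ : ∀ {a} {z : Subset n} → a ∉ z → (a ∈ᵇ z) ≡ false
  ∉⇒∈ᵇ a∉z = BoolP.¬-not λ e → a∉z (∈ᵇ⇒∈ e)

  not∈ᵇ⇒∉ : ∀ {a} {z : Subset n} → not (a ∈ᵇ z) ≡ true → a ∉ z
  not∈ᵇ⇒∉ t a∈z with () ← subst (λ c → not c ≡ true) (∈⇒∈ᵇ a∈z) t

  ∈ᵇ-lookup : ∀ a (z : Subset n) → (a ∈ᵇ z) ≡ lookup z a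
  ∈ᵇ-lookup a z = bool-ext (λ e → ∈⇒lookup (∈ᵇ⇒∈ {a} {z} e)) (λ e → ∈⇒∈ᵇ (lookup⇒∈ {a} {z} e))

  ⊆ᵇ⇒⊆ : ∀ {x y : Subset n} → (x ⊆ᵇ y) ≡ true → x ⊆ y
  ⊆ᵇ⇒⊆ {x} {y} = does-true (x FSP.⊆? y)

  ⊆⇒⊆ᵇ : ∀ {x y : Subset n} → x ⊆ y → (x ⊆ᵇ y) ≡ true
  ⊆⇒⊆ᵇ {x} {y} = dec-true (x FSP.⊆? y)

  ≡ˢ⇒≡ : ∀ {x y : Subset n} → (x ≡ˢ y) ≡ true → x ≡ y
  ≡ˢ⇒≡ {x} {y} = does-true (VP.≡-dec BoolP._≟_ x y)

  ≡ˢ-refl : ∀ (x : Subset n) → (x ≡ˢ x) ≡ true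
  ≡ˢ-refl x = dec-true (VP.≡-dec BoolP._≟_ x x) refl

sumL : ∀ {A : Set} → List A → (A → ℕ) → ℕ
sumL xs g = L.foldr (λ x acc → g x N.+ acc) 0 xs

module _ {A : Set} where

  sumL-cong : ∀ (xs : List A) {g h : A → ℕ} → (∀ x → g x ≡ h x) → sumL xs g ≡ sumL xs h
  sumL-cong [] _ = refl
  sumL-cong (x ∷ xs) g≗h = cong₂ N._+_ (g≗h x) (sumL-cong xs g≗h)

  sumL-zero : ∀ (xs : List A) {g : A → ℕ} → (∀ x → g x ≡ 0) → sumL xs g ≡ 0
  sumL-zero [] _ = refl
  sumL-zero (x ∷ xs) g≗0 = cong₂ N._+_ (g≗0 x) (sumL-zero xs g≗0)

  sumL-mono : ∀ (xs : List A) {g h : A → ℕ} → (∀ x → g x N.≤ h x) → sumL xs g N.≤ sumL xs h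
  sumL-mono [] _ = N.z≤n
  sumL-mono (x ∷ xs) g≤h = NP.+-mono-≤ (g≤h x) (sumL-mono xs g≤h)

  sumL-+ : ∀ (xs : List A) (g h : A → ℕ) → sumL xs (λ x → g x N.+ h x) ≡ sumL xs g N.+ sumL xs h
  sumL-+ [] g h = refl
  sumL-+ (x ∷ xs) g h = begin
    (g x N.+ h x) N.+ sumL xs (λ x → g x N.+ h x) ≡⟨ cong ((g x N.+ h x) N.+_) (sumL-+ xs g h) ⟩
    (g x N.+ h x) N.+ (sumL xs g N.+ sumL xs h)   ≡⟨ +-interchange (g x) (h x) (sumL xs g) (sumL xs h) ⟩
    (g x N.+ sumL xs g) N.+ (h x N.+ sumL xs h)   ∎
    where open ≡-Reasoning

  sumL-* : ∀ (xs : List A) c (g : A → ℕ) → sumL xs (λ x → c * g x) ≡ c * sumL xs g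
  sumL-* [] c g = sym (NP.*-zeroʳ c)
  sumL-* (x ∷ xs) c g = trans (cong (c * g x N.+_) (sumL-* xs c g)) (sym (NP.*-distribˡ-+ c (g x) (sumL xs g)))

  sumL-const : ∀ (xs : List A) k → sumL xs (λ _ → k) ≡ L.length xs * k
  sumL-const [] k = refl
  sumL-const (x ∷ xs) k = cong (k N.+_) (sumL-const xs k)

  sumL-++ : ∀ (xs ys : List A) (g : A → ℕ) → sumL (xs ++ ys) g ≡ sumL xs g N.+ sumL ys g
  sumL-++ [] ys g = refl
  sumL-++ (x ∷ xs) ys g = trans (cong (g x N.+_) (sumL-++ xs ys g)) (sym (NP.+-assoc (g x) (sumL xs g) (sumL ys g)))

  sumL-map : ∀ {B : Set} (f : B → A) (xs : List B) (g : A → ℕ) → sumL (L.map f xs) g ≡ sumL xs (g ∘ f)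
  sumL-map f [] g = refl
  sumL-map f (x ∷ xs) g = cong (g (f x) N.+_) (sumL-map f xs g)

sumL-+₃ : ∀ {A : Set} (xs : List A) (f g h : A → ℕ) →
  sumL xs (λ x → f x N.+ g x N.+ h x) ≡ sumL xs f N.+ sumL xs g N.+ sumL xs h
sumL-+₃ xs f g h = trans (sumL-+ xs (λ x → f x N.+ g x) h) (cong (N._+ sumL xs h) (sumL-+ xs f g))

cancel-≤ : ∀ {x y p q} → x N.+ p ≡ y N.+ q → q N.≤ p → x N.≤ y
cancel-≤ {x} {y} {p} {q} eq q≤p = NP.+-cancelʳ-≤ p x y (subst (N._≤ y N.+ p) (sym eq) (NP.+-monoʳ-≤ y q≤p))

cancel-≡ : ∀ {x y p q} → x N.+ p ≡ y N.+ q → p ≡ q → x ≡ y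
cancel-≡ {x} {y} {p} eq refl = NP.+-cancelʳ-≡ p x y eq

sumL-swap : ∀ {A B : Set} (xs : List A) (ys : List B) (g : A → B → ℕ) →
  sumL xs (λ x → sumL ys (g x)) ≡ sumL ys (λ y → sumL xs (λ x → g x y))
sumL-swap [] ys g = sym (sumL-zero ys (λ _ → refl))
sumL-swap (x ∷ xs) ys g = trans (cong (sumL ys (g x) N.+_) (sumL-swap xs ys g))
  (sym (sumL-+ ys (g x) (λ y → sumL xs (λ x′ → g x′ y))))

Σˢ : ∀ {n} → (Subset n → ℕ) → ℕ
Σˢ {n} = sumL (allSubsets n)

Σᵉ : ∀ {n} → (Fin n → ℕ) → ℕ
Σᵉ {n} = sumL (allFin n)

Σˢ-suc : ∀ {n} (g : Subset (N.suc n) → ℕ) → Σˢ g ≡ Σˢ (g ∘ (false ∷_)) N.+ Σˢ (g ∘ (true ∷_))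
Σˢ-suc {n} g = trans (sumL-++ (L.map (false ∷_) (allSubsets n)) _ g)
  (cong₂ N._+_ (sumL-map _ (allSubsets n) g) (sumL-map _ (allSubsets n) g))

Σᵉ-suc : ∀ {n} (g : Fin (N.suc n) → ℕ) → Σᵉ g ≡ g Fin.zero N.+ Σᵉ (g ∘ Fin.suc)
Σᵉ-suc {n} g = cong (g Fin.zero N.+_) (trans (cong (λ xs → sumL xs g) (sym (LP.map-tabulate id Fin.suc)))
  (sumL-map Fin.suc (allFin n) g))

Σᵉ-const : ∀ {n} k → Σᵉ {n} (λ _ → k) ≡ n * k
Σᵉ-const {n} k = trans (sumL-const (allFin n) k) (cong (_* k) (LP.length-tabulate {n = n} id))

⟦_⟧ : Bool → ℕ
⟦ true ⟧ = 1
⟦ false ⟧ = 0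

size-as-count : ∀ {n} (z : Subset n) → FS.∣ z ∣ ≡ Σᵉ (λ a → ⟦ a ∈ᵇ z ⟧)
size-as-count z = trans (lookup-count z) (sumL-cong (allFin _) (λ a → cong ⟦_⟧ (sym (∈ᵇ-lookup a z))))
  where
  lookup-count : ∀ {n} (z : Subset n) → FS.∣ z ∣ ≡ Σᵉ (λ a → ⟦ lookup z a ⟧)
  lookup-count [] = refl
  lookup-count (true ∷ z) = trans (cong N.suc (lookup-count z)) (sym (Σᵉ-suc (λ a → ⟦ lookup (true ∷ z) a ⟧)))
  lookup-count (false ∷ z) = trans (lookup-count z) (sym (Σᵉ-suc (λ a → ⟦ lookup (false ∷ z) a ⟧)))

∈-allSubsets : ∀ {n} (z : Subset n) → z ∈ˡ allSubsets n
∈-allSubsets [] = here refl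
∈-allSubsets {N.suc n} (false ∷ z) = ∈-++⁺ˡ (∈-map⁺ (false ∷_) (∈-allSubsets z))
∈-allSubsets {N.suc n} (true ∷ z) = ∈-++⁺ʳ (L.map (false ∷_) (allSubsets n)) (∈-map⁺ (true ∷_) (∈-allSubsets z))

singleton-count : ∀ {n} (x : Subset n) → Σˢ (λ z → ⟦ x ≡ˢ z ⟧) ≡ 1
singleton-count [] = refl
singleton-count {N.suc n} (false ∷ x) = trans (Σˢ-suc (λ z → ⟦ (false ∷ x) ≡ˢ z ⟧))
  (cong₂ N._+_ (singleton-count x) (sumL-zero (allSubsets n) (λ _ → refl)))
singleton-count {N.suc n} (true ∷ x) = trans (Σˢ-suc (λ z → ⟦ (true ∷ x) ≡ˢ z ⟧))
  (trans (cong (N._+ Σˢ (λ z → ⟦ x ≡ˢ z ⟧)) (sumL-zero (allSubsets n) (λ _ → refl))) (singleton-count x))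

any-sound : ∀ {A : Set} (p : A → Bool) (xs : List A) → any p xs ≡ true → ∃ λ x → p x ≡ true
any-sound p xs e with satisfied (any⁻ p xs (Equivalence.from BoolP.T-≡ e))
... | x , px = x , Equivalence.to BoolP.T-≡ px

any-complete : ∀ {n} (p : Subset n → Bool) (z : Subset n) → p z ≡ true → any p (allSubsets n) ≡ true
any-complete p z e = Equivalence.to BoolP.T-≡ (any⁺ p (lose (∈-allSubsets z) (Equivalence.from BoolP.T-≡ e)))

any-cong : ∀ {A : Set} {p q : A → Bool} (xs : List A) → (∀ x → p x ≡ q x) → any p xs ≡ any q xs
any-cong [] _ = refl
any-cong (x ∷ xs) p≗q = cong₂ _∨_ (p≗q x) (any-cong xs p≗q)

module _ {n : ℕ} (φ : Subset n → Subset n) where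

  image-elim : ∀ {G : Fam n} {η} → image φ G η ≡ true → ∃ λ z → G z ≡ true × φ z ≡ η
  image-elim {G} {η} e with any-sound _ (allSubsets n) e
  ... | z , q = z , ∧-trueˡ q , ≡ˢ⇒≡ (∧-trueʳ {G z} q)

  image-intro : ∀ {G : Fam n} z → G z ≡ true → image φ G (φ z) ≡ true
  image-intro z Gz = any-complete _ z (∧-true⁺ Gz (≡ˢ-refl (φ z)))

  image-∧ : ∀ (G Q : Fam n) η → (image φ G η ∧ Q η) ≡ image φ (λ z → G z ∧ Q (φ z)) η
  image-∧ G Q η = bool-ext to from
    where
    to : image φ G η ∧ Q η ≡ true → image φ (λ z → G z ∧ Q (φ z)) η ≡ true
    to e with image-elim {G} (∧-trueˡ e)
    ... | z , Gz , refl = image-intro z (∧-true⁺ Gz (∧-trueʳ {image φ G (φ z)} e))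
    from : image φ (λ z → G z ∧ Q (φ z)) η ≡ true → image φ G η ∧ Q η ≡ true
    from e with image-elim {λ z → G z ∧ Q (φ z)} e
    ... | z , GQz , refl = ∧-true⁺ (image-intro z (∧-trueˡ GQz)) (∧-trueʳ {G z} GQz)

  image-cong : ∀ {G H : Fam n} → (∀ z → G z ≡ H z) → ∀ η → image φ G η ≡ image φ H η
  image-cong G≗H η = any-cong (allSubsets n) (λ z → cong (_∧ (φ z ≡ˢ η)) (G≗H z))

card-sum : ∀ {n} (G : Fam n) → card G ≡ Σˢ (λ z → ⟦ G z ⟧)
card-sum {n} G = go (allSubsets n)
  where
  go : ∀ xs → L.length (L.filter (λ z → G z BoolP.≟ true) xs) ≡ sumL xs (λ z → ⟦ G z ⟧)
  go [] = refl
  go (x ∷ xs) with G x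
  ... | true = cong N.suc (go xs)
  ... | false = go xs

card-cong : ∀ {n} {G H : Fam n} → (∀ z → G z ≡ H z) → card G ≡ card H
card-cong {G = G} {H} G≗H = trans (card-sum G) (trans (sumL-cong (allSubsets _) (cong ⟦_⟧ ∘ G≗H)) (sym (card-sum H)))

card-mono : ∀ {n} {G H : Fam n} → (∀ z → G z ≡ true → H z ≡ true) → card G N.≤ card H
card-mono {G = G} {H} G⊆H = subst₂ N._≤_ (sym (card-sum G)) (sym (card-sum H))
  (sumL-mono (allSubsets _) indicator-mono)
  where
  indicator-mono : ∀ z → ⟦ G z ⟧ N.≤ ⟦ H z ⟧
  indicator-mono z with G z | G⊆H z
  ... | false | _ = N.z≤n
  ... | true | Hz = NP.≤-reflexive (cong ⟦_⟧ (sym (Hz refl)))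

InjectiveOn : ∀ {n} → Fam n → (Subset n → Subset n) → Set
InjectiveOn G φ = ∀ x y → G x ≡ true → G y ≡ true → φ x ≡ φ y → x ≡ y

-- An injective map preserves the size of a family: each image point has
-- exactly one preimage, so counting pairs (z, φ z) both ways gives the result.
card-image : ∀ {n} (G : Fam n) (φ : Subset n → Subset n) → InjectiveOn G φ → card (image φ G) ≡ card G
card-image {n} G φ inj = begin
  card (image φ G)                                    ≡⟨ card-sum (image φ G) ⟩
  Σˢ (λ η → ⟦ image φ G η ⟧)                          ≡⟨ sumL-cong (allSubsets n) (λ η → sym (fibre η)) ⟩
  Σˢ (λ η → Σˢ (λ z → ⟦ G z ∧ (φ z ≡ˢ η) ⟧))          ≡⟨ sumL-swap (allSubsets n) (allSubsets n) _ ⟩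
  Σˢ (λ z → Σˢ (λ η → ⟦ G z ∧ (φ z ≡ˢ η) ⟧))          ≡⟨ sumL-cong (allSubsets n) graph ⟩
  Σˢ (λ z → ⟦ G z ⟧)                                  ≡⟨ sym (card-sum G) ⟩
  card G                                              ∎
  where
  open ≡-Reasoning
  fibre : ∀ η → Σˢ (λ z → ⟦ G z ∧ (φ z ≡ˢ η) ⟧) ≡ ⟦ image φ G η ⟧
  fibre η with image φ G η in e
  ... | false = sumL-zero (allSubsets n) λ z →
          cong ⟦_⟧ (BoolP.¬-not λ t → BoolP.not-¬ e (any-complete _ z t))
  ... | true with image-elim φ {G} e
  ...   | z₀ , Gz₀ , refl = trans (sumL-cong (allSubsets n) (cong ⟦_⟧ ∘ unique)) (singleton-count z₀)
    where
    unique : ∀ z → (G z ∧ (φ z ≡ˢ φ z₀)) ≡ (z₀ ≡ˢ z)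
    unique z = bool-ext
      (λ t → subst (λ w → (z₀ ≡ˢ w) ≡ true) (inj z₀ z Gz₀ (∧-trueˡ t) (sym (≡ˢ⇒≡ (∧-trueʳ {G z} t)))) (≡ˢ-refl z₀))
      (λ t → subst (λ w → (G w ∧ (φ w ≡ˢ φ z₀)) ≡ true) (≡ˢ⇒≡ t) (∧-true⁺ Gz₀ (≡ˢ-refl (φ z₀))))
  graph : ∀ z → Σˢ (λ η → ⟦ G z ∧ (φ z ≡ˢ η) ⟧) ≡ ⟦ G z ⟧
  graph z with G z
  ... | true = singleton-count (φ z)
  ... | false = sumL-zero (allSubsets n) (λ _ → refl)

card-transfer : ∀ {n} (G Q : Fam n) (φ : Subset n → Subset n) → InjectiveOn G φ →
  card (λ η → image φ G η ∧ Q η) ≡ card (λ z → G z ∧ Q (φ z))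
card-transfer G Q φ inj = trans (card-cong (image-∧ φ G Q))
  (card-image (λ z → G z ∧ Q (φ z)) φ (λ x y Gx Gy → inj x y (∧-trueˡ Gx) (∧-trueˡ Gy)))

module _ {n : ℕ} (S : Fam n) where

  upset-intro : ∀ {z x} → S z ≡ true → z ⊆ x → upset S x ≡ true
  upset-intro {z} Sz z⊆x = any-complete _ z (∧-true⁺ Sz (⊆⇒⊆ᵇ z⊆x))

  upset-elim : ∀ {x} → upset S x ≡ true → ∃ λ z → S z ≡ true × z ⊆ x
  upset-elim x∈ with any-sound _ (allSubsets n) x∈
  ... | z , q = z , ∧-trueˡ q , ⊆ᵇ⇒⊆ (∧-trueʳ {S z} q)

  upset-mono : ∀ {x y} → x ⊆ y → upset S x ≡ true → upset S y ≡ true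
  upset-mono x⊆y x∈ with upset-elim x∈
  ... | z , Sz , z⊆x = upset-intro Sz (FSP.⊆-trans z⊆x x⊆y)

-- Shifting along a letter a.  In a family W closed under adding a, the map
-- z ↦ z ∪ {a} is a bijection from the members avoiding a onto the members η
-- containing a with η ∖ {a} ∈ W.
shift-count : ∀ {n} (W : Fam n) a → (∀ η → W η ≡ true → W (add η a) ≡ true) →
  card (λ η → W η ∧ not (a ∈ᵇ η)) ≡ card (λ η → W η ∧ ((a ∈ᵇ η) ∧ W (del η a)))
shift-count {n} W a closed = trans (sym (card-image avoiding (λ z → add z a) add-injective)) (card-cong image-is)
  where
  avoiding : Fam n
  avoiding η = W η ∧ not (a ∈ᵇ η)

  add-injective : InjectiveOn avoiding (λ z → add z a)
  add-injective x y x∈ y∈ eq = begin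
    x                 ≡⟨ sym (del-add x a (not∈ᵇ⇒∉ (∧-trueʳ {W x} x∈))) ⟩
    del (add x a) a   ≡⟨ cong (λ w → del w a) eq ⟩
    del (add y a) a   ≡⟨ del-add y a (not∈ᵇ⇒∉ (∧-trueʳ {W y} y∈)) ⟩
    y                 ∎
    where open ≡-Reasoning

  image-is : ∀ η → image (λ z → add z a) avoiding η ≡ (W η ∧ ((a ∈ᵇ η) ∧ W (del η a)))
  image-is η = bool-ext to from
    where
    to : image (λ z → add z a) avoiding η ≡ true → W η ∧ ((a ∈ᵇ η) ∧ W (del η a)) ≡ true
    to t with image-elim (λ z → add z a) {avoiding} t
    ... | z , z∈ , refl = ∧-true⁺ (closed z (∧-trueˡ z∈)) (∧-true⁺ (∈⇒∈ᵇ (∈-add-self z a))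
            (subst (λ w → W w ≡ true) (sym (del-add z a (not∈ᵇ⇒∉ (∧-trueʳ {W z} z∈)))) (∧-trueˡ z∈)))
    from : W η ∧ ((a ∈ᵇ η) ∧ W (del η a)) ≡ true → image (λ z → add z a) avoiding η ≡ true
    from t = subst (λ w → image (λ z → add z a) avoiding w ≡ true) (add-del η a (∈ᵇ⇒∈ (∧-trueˡ rest)))
      (image-intro (λ z → add z a) (del η a)
        (∧-true⁺ (∧-trueʳ {a ∈ᵇ η} rest) (cong not (∉⇒∈ᵇ (∉-del-self η a)))))
      where
      rest : (a ∈ᵇ η) ∧ W (del η a) ≡ true
      rest = ∧-trueʳ {W η} t

minimal-below : ∀ {n} (F : Fam n) {x} → F x ≡ true → ∃ λ m → minFam F m ≡ true × m ⊆ x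
minimal-below {n} F {x} Fx = descend x (⊂-wellFounded x) Fx
  where
  descend : ∀ x → Acc FS._⊂_ x → F x ≡ true → ∃ λ m → minFam F m ≡ true × m ⊆ x
  descend x (acc smaller) Fx with any (λ g → F g ∧ (g ⊂ᵇ x)) (allSubsets n) in e
  ... | false = x , cong₂ (λ p c → p ∧ not c) Fx e , FSP.⊆-refl
  ... | true with any-sound _ (allSubsets n) e
  ...   | g , q =
          let g⊂x = does-true (g FSP.⊂? x) (∧-trueʳ {F g} q)
              (m , m-min , m⊆g) = descend g (smaller g⊂x) (∧-trueˡ q)
          in m , m-min , FSP.⊆-trans m⊆g (FSP.p⊂q⇒p⊆q g⊂x)

Done : ∀ {n} → List (Fin n) → Fin n → Set
Done todo i = ¬ (i ∈ˡ todo)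

record RisingInvariant {n} (F : Fam n) (todo : List (Fin n)) (φ : Subset n → Subset n) : Set where
  field
    extensive : ∀ f → F f ≡ true → f ⊆ φ f
    reflecting : ∀ s f → F s ≡ true → F f ≡ true → s ⊆ φ f → s ⊆ f
    raised-closed : ∀ i → Done todo i → ∀ x → image φ F x ≡ true → image φ F (add x i) ≡ true
    absorbing : ∀ x s → image φ F x ≡ true → F s ≡ true →
      (∀ {i} → Done todo i → i ∈ s → i ∈ x) → image φ F (x ∪ s) ≡ true

initial-invariant : ∀ {n} (F : Fam n) → UnionClosed F → RisingInvariant F (allFin n) id
initial-invariant F uc = record
  { extensive = λ _ _ i∈ → i∈
  ; reflecting = λ _ _ _ _ s⊆ → s⊆
  ; raised-closed = λ i i-done → ⊥-elim (i-done (∈-allFin i))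
  ; absorbing = λ x s x∈ Fs _ → image-intro id (x ∪ s) (uc x s (member x∈) Fs)
  }
  where
  member : ∀ {x} → image id F x ≡ true → F x ≡ true
  member x∈ with image-elim id {F} x∈
  ... | z , Fz , refl = Fz

module RisingStep {n} (F : Fam n) (b : Fin n) (bs : List (Fin n)) (φ : Subset n → Subset n)
                  (inv : RisingInvariant F (b ∷ bs) φ) where
  open RisingInvariant inv

  T : Fam n
  T = image φ F

  ψ : Subset n → Subset n
  ψ = rise T b

  T′ : Fam n
  T′ = image (ψ ∘ φ) F

  data Outcome (y : Subset n) : Set where
    kept   : T (add y b) ≡ true → ψ y ≡ y → Outcome y
    raised : T (add y b) ≡ false → ψ y ≡ add y b → Outcome y

  outcome : ∀ y → Outcome y
  outcome y with T (add y b) in e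
  ... | true = kept e (cong (λ c → if c then y else add y b) e)
  ... | false = raised e (cong (λ c → if c then y else add y b) e)

  ψ-extensive : ∀ y → y ⊆ ψ y
  ψ-extensive y with outcome y
  ... | kept _ eq = λ i∈ → subst (_ ∈_) (sym eq) i∈
  ... | raised _ eq = λ i∈ → subst (_ ∈_) (sym eq) (⊆-add i∈)

  ψ-add : ∀ y → add (ψ y) b ≡ add y b
  ψ-add y with outcome y
  ... | kept _ eq = cong (λ w → add w b) eq
  ... | raised _ eq = trans (cong (λ w → add w b) eq) (add-idem y b)

  ψ-away : ∀ y {i} → i ≢ b → i ∈ ψ y → i ∈ y
  ψ-away y i≢b i∈ with outcome y
  ... | kept _ eq = subst (_ ∈_) eq i∈
  ... | raised _ eq with ∈-add⁻ (subst (_ ∈_) eq i∈)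
  ...   | inj₁ i≡b = ⊥-elim (i≢b i≡b)
  ...   | inj₂ i∈y = i∈y

  T′-elim : ∀ {x} → T′ x ≡ true → ∃ λ y → T y ≡ true × ψ y ≡ x
  T′-elim x∈ with image-elim (ψ ∘ φ) {F} x∈
  ... | f , Ff , eq = φ f , image-intro φ f Ff , eq

  T′-intro : ∀ y → T y ≡ true → T′ (ψ y) ≡ true
  T′-intro y y∈ with image-elim φ {F} y∈
  ... | f , Ff , refl = image-intro (ψ ∘ φ) f Ff

  T′-kept : ∀ y → T y ≡ true → T (add y b) ≡ true → T′ y ≡ true
  T′-kept y y∈ yb∈ with outcome y
  ... | kept _ eq = subst (λ w → T′ w ≡ true) eq (T′-intro y y∈)
  ... | raised yb∉ _ with () ← trans (sym yb∈) yb∉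

  T′-raised : ∀ y → T y ≡ true → T′ (add y b) ≡ true
  T′-raised y y∈ with outcome y
  ... | kept yb∈ _ = T′-kept (add y b) yb∈ (subst (λ w → T w ≡ true) (sym (add-idem y b)) yb∈)
  ... | raised _ eq = subst (λ w → T′ w ≡ true) eq (T′-intro y y∈)

  done-before : ∀ {i} → Done bs i → i ≡ b ⊎ Done (b ∷ bs) i
  done-before {i} i-done with i Fin.≟ b
  ... | yes i≡b = inj₁ i≡b
  ... | no i≢b = inj₂ λ { (here i≡b) → i≢b i≡b ; (there i∈bs) → i-done i∈bs }

  done-≢ : ∀ {i} → Done (b ∷ bs) i → i ≢ b
  done-≢ i-done i≡b = i-done (here i≡b)

  raised-closed′ : ∀ i → Done bs i → ∀ x → T′ x ≡ true → T′ (add x i) ≡ true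
  raised-closed′ i i-done x x∈ with T′-elim x∈
  ... | y , y∈ , refl with done-before i-done
  ...   | inj₁ refl = subst (λ w → T′ w ≡ true) (sym (ψ-add y)) (T′-raised y y∈)
  ...   | inj₂ i-done′ with outcome y
  ...     | kept yb∈ eq = subst (λ w → T′ (add w i) ≡ true) (sym eq)
              (T′-kept (add y i) (raised-closed i i-done′ y y∈)
                (subst (λ w → T w ≡ true) (add-comm y (done-≢ i-done′ ∘ sym))
                  (raised-closed i i-done′ (add y b) yb∈)))
  ...     | raised _ eq = subst (λ w → T′ (add w i) ≡ true) (sym eq)
              (subst (λ w → T′ w ≡ true) (add-comm y (done-≢ i-done′))
                (T′-raised (add y i) (raised-closed i i-done′ y y∈)))

  absorbing′ : ∀ x s → T′ x ≡ true → F s ≡ true → (∀ {i} → Done bs i → i ∈ s → i ∈ x) → T′ (x ∪ s) ≡ true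
  absorbing′ x s x∈ Fs s-below with T′-elim x∈
  ... | y , y∈ , refl with outcome y
  ...   | kept yb∈ eq = subst (λ w → T′ (w ∪ s) ≡ true) (sym eq)
            (T′-kept (y ∪ s) y∪s∈ (subst (λ w → T w ≡ true) (sym (add-∪ y s b))
              (absorbing (add y b) s yb∈ Fs (λ i-done i∈s → ⊆-add (s-below-y i-done i∈s)))))
    where
    s-below-y : ∀ {i} → Done (b ∷ bs) i → i ∈ s → i ∈ y
    s-below-y i-done i∈s = ψ-away y (done-≢ i-done) (s-below (λ i∈bs → i-done (there i∈bs)) i∈s)
    y∪s∈ : T (y ∪ s) ≡ true
    y∪s∈ = absorbing y s y∈ Fs s-below-y
  ...   | raised _ eq = subst (λ w → T′ (w ∪ s) ≡ true) (sym eq)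
            (subst (λ w → T′ w ≡ true) (add-∪ y s b) (T′-raised (y ∪ s) y∪s∈))
    where
    s-below-y : ∀ {i} → Done (b ∷ bs) i → i ∈ s → i ∈ y
    s-below-y i-done i∈s = ψ-away y (done-≢ i-done) (s-below (λ i∈bs → i-done (there i∈bs)) i∈s)
    y∪s∈ : T (y ∪ s) ≡ true
    y∪s∈ = absorbing y s y∈ Fs s-below-y

  -- If φ f was raised by b and s ∋ b lay below the result, then absorbing s
  -- into φ f would already produce φ f ∪ {b}; so b ∉ s and s ⊆ φ f.
  reflecting′ : ∀ s f → F s ≡ true → F f ≡ true → s ⊆ ψ (φ f) → s ⊆ f
  reflecting′ s f Fs Ff s⊆ with outcome (φ f)
  ... | kept _ eq = reflecting s f Fs Ff (λ i∈ → subst (_ ∈_) eq (s⊆ i∈))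
  ... | raised fb∉ eq = reflecting s f Fs Ff s⊆φf
    where
    s⊆add : s ⊆ add (φ f) b
    s⊆add i∈ = subst (_ ∈_) eq (s⊆ i∈)
    s-below : ∀ {i} → Done (b ∷ bs) i → i ∈ s → i ∈ φ f
    s-below i-done i∈s with ∈-add⁻ (s⊆add i∈s)
    ... | inj₁ i≡b = ⊥-elim (done-≢ i-done i≡b)
    ... | inj₂ i∈φf = i∈φf
    s⊆φf : s ⊆ φ f
    s⊆φf i∈s with ∈-add⁻ (s⊆add i∈s)
    ... | inj₂ i∈φf = i∈φf
    ... | inj₁ refl with () ← trans (sym (subst (λ w → T w ≡ true) (∪-fills-add (φ f) s b s⊆add i∈s)
                                   (absorbing (φ f) s (image-intro φ f Ff) Fs s-below))) fb∉

  next : RisingInvariant F bs (ψ ∘ φ)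
  next = record
    { extensive = λ f Ff i∈ → ψ-extensive (φ f) (extensive f Ff i∈)
    ; reflecting = reflecting′
    ; raised-closed = raised-closed′
    ; absorbing = absorbing′
    }

rising-invariant : ∀ {n} (F : Fam n) todo {φ} → RisingInvariant F todo φ → RisingInvariant F [] (risingFrom F φ todo)
rising-invariant F [] inv = inv
rising-invariant F (b ∷ bs) {φ} inv = rising-invariant F bs (RisingStep.next F b bs φ inv)

module RisingFacts {n} {F : Fam n} {todo} {φ} (inv : RisingInvariant F todo φ) where
  open RisingInvariant inv

  -- φ is injective on F: if φ f = φ g, each of f, g lies below the other's image.
  injective : InjectiveOn F φ
  injective f g Ff Fg eq = FSP.⊆-antisym
    (reflecting f g Ff Fg (λ i∈ → subst (_ ∈_) eq (extensive f Ff i∈)))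
    (reflecting g f Fg Ff (λ i∈ → subst (_ ∈_) (sym eq) (extensive g Fg i∈)))

  -- A spurious element a ∈ φ f ∖ f cannot be removed inside φ(F): if φ g = φ f ∖ {a},
  -- then g ⊆ f and f ⊆ g, so φ f = φ f ∖ {a}, which misses a.
  spurious-essential : ∀ f a → F f ≡ true → a ∉ f → a ∈ φ f → image φ F (del (φ f) a) ≡ false
  spurious-essential f a Ff a∉f a∈φf = BoolP.¬-not removable-absurd
    where
    removable-absurd : image φ F (del (φ f) a) ≢ true
    removable-absurd t with image-elim φ {F} t
    ... | g , Fg , φg≡ = ∉-del-self (φ f) a (subst (a ∈_) φf≡ a∈φf)
      where
      g⊆f : g ⊆ f
      g⊆f = reflecting g f Fg Ff (λ i∈ → del-⊆ (subst (_ ∈_) φg≡ (extensive g Fg i∈)))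
      f⊆g : f ⊆ g
      f⊆g = reflecting f g Ff Fg (λ i∈ → subst (_ ∈_) (sym φg≡) (∈-del⁺ (extensive f Ff i∈) λ { refl → a∉f i∈ }))
      φf≡ : φ f ≡ del (φ f) a
      φf≡ = trans (cong φ (FSP.⊆-antisym f⊆g g⊆f)) φg≡

  upset-invariant : ∀ (S : Fam n) → SubFamily S F → ∀ f → F f ≡ true → upset S (φ f) ≡ upset S f
  upset-invariant S S⊆F f Ff = bool-ext below-f (upset-mono S (extensive f Ff))
    where
    below-f : upset S (φ f) ≡ true → upset S f ≡ true
    below-f t with upset-elim S t
    ... | z , Sz , z⊆φf = upset-intro S Sz (reflecting z f (S⊆F z Sz) Ff z⊆φf)

module Counting {n} (F S : Fam n) (uc : UnionClosed F) (S⊆F : SubFamily S F) where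

  φ : Subset n → Subset n
  φ = φw F

  inv : RisingInvariant F [] φ
  inv = rising-invariant F (allFin n) (initial-invariant F uc)

  open RisingInvariant inv
  open RisingFacts inv

  U R V : Fam n
  U = image φ F
  R = restrictTo F S
  V = image φ R

  R-injective : InjectiveOn R φ
  R-injective x y Rx Ry = injective x y (∧-trueˡ Rx) (∧-trueˡ Ry)

  V-char : ∀ η → V η ≡ (U η ∧ upset S η)
  V-char η = trans (image-cong φ pulled-back η) (sym (image-∧ φ F (upset S) η))
    where
    pulled-back : ∀ z → R z ≡ (F z ∧ upset S (φ z))
    pulled-back z with F z in Fz
    ... | true = sym (upset-invariant S S⊆F z Fz)
    ... | false = refl

  -- φ(F[S]) is an up-set: both φ(F) (all letters are done) and S↑ are.
  V-raised : ∀ a η → V η ≡ true → V (add η a) ≡ true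
  V-raised a η t = trans (V-char (add η a)) (∧-true⁺
    (raised-closed a (λ ()) η (∧-trueˡ t′)) (upset-mono S ⊆-add (∧-trueʳ {U η} t′)))
    where
    t′ : U η ∧ upset S η ≡ true
    t′ = trans (sym (V-char η)) t

  image-covered : (∀ f → F f ≡ true → upset S f ≡ true) → ∀ η → U η ≡ true → V η ≡ true
  image-covered covered η Uη with image-elim φ {F} Uη
  ... | g , Fg , refl = image-intro φ g (∧-true⁺ Fg (covered g Fg))

  pullback : ∀ (g Q : Fam n) →
    card (λ η → image φ (λ z → F z ∧ g z) η ∧ (Q η ∧ upset S η)) ≡ card (λ z → R z ∧ (g z ∧ Q (φ z)))
  pullback g Q = trans
    (card-transfer (λ z → F z ∧ g z) (λ η → Q η ∧ upset S η) φ
      (λ x y x∈ y∈ → injective x y (∧-trueˡ x∈) (∧-trueˡ y∈)))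
    (card-cong regroup)
    where
    regroup : ∀ z → ((F z ∧ g z) ∧ (Q (φ z) ∧ upset S (φ z))) ≡ (R z ∧ (g z ∧ Q (φ z)))
    regroup z with F z in Fz
    ... | false = refl
    ... | true = trans (cong (λ u → g z ∧ (Q (φ z) ∧ u)) (upset-invariant S S⊆F z Fz))
                       (∧-Props.x∙yz≈z∙xy (g z) (Q (φ z)) (upset S z))

  module Letter (a : Fin n) where

    member pureᶻ spuriousᶻ removable absent droppable : Fam n
    member z    = R z ∧ (a ∈ᵇ z)
    pureᶻ z     = R z ∧ ((a ∈ᵇ z) ∧ not (U (del (φ z) a)))
    spuriousᶻ z = R z ∧ (not (a ∈ᵇ z) ∧ (a ∈ᵇ φ z))
    removable z = R z ∧ ((a ∈ᵇ z) ∧ U (del (φ z) a))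
    absent z    = R z ∧ not (a ∈ᵇ φ z)
    droppable z = R z ∧ ((a ∈ᵇ φ z) ∧ V (del (φ z) a))

    pure-count : card (pure F a ∩ᶠ upset S) ≡ card pureᶻ
    pure-count = trans
      (card-cong (λ η → BoolP.∧-assoc (image φ (withElem F a) η) (not (U (del η a))) (upset S η)))
      (pullback (a ∈ᵇ_) (λ η → not (U (del η a))))

    spurious-count : card (spurious F a ∩ᶠ upset S) ≡ card spuriousᶻ
    spurious-count = trans (card-cong as-image) (pullback (λ z → not (a ∈ᵇ z)) (a ∈ᵇ_))
      where
      as-image : ∀ η → (spurious F a η ∧ upset S η) ≡
                       (image φ (λ z → F z ∧ not (a ∈ᵇ z)) η ∧ ((a ∈ᵇ η) ∧ upset S η))
      as-image η = trans
        (cong (λ c → ((a ∈ᵇ η) ∧ c) ∧ upset S η)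
          (any-cong (allSubsets n) (λ f → ∧-Props.x∙yz≈xz∙y (F f) (φ f ≡ˢ η) (not (a ∈ᵇ f)))))
        (∧-Props.xy∙z≈y∙xz (a ∈ᵇ η) (image φ (λ z → F z ∧ not (a ∈ᵇ z)) η) (upset S η))

    -- Pointwise, for z ∈ F[S] (using a ∈ z ⇒ a ∈ φ z):
    --   1 + [pure] + [removable] = 2 [a ∈ z] + [spurious] + [a ∉ φ z].
    balance : card R N.+ card pureᶻ N.+ card removable ≡ 2 * card member N.+ card spuriousᶻ N.+ card absent
    balance = begin
      card R N.+ card pureᶻ N.+ card removable
        ≡⟨ cong₂ N._+_ (cong₂ N._+_ (card-sum R) (card-sum pureᶻ)) (card-sum removable) ⟩
      Σˢ (λ z → ⟦ R z ⟧) N.+ Σˢ (λ z → ⟦ pureᶻ z ⟧) N.+ Σˢ (λ z → ⟦ removable z ⟧)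
        ≡⟨ sym (sumL-+₃ (allSubsets n) _ _ _) ⟩
      Σˢ (λ z → ⟦ R z ⟧ N.+ ⟦ pureᶻ z ⟧ N.+ ⟦ removable z ⟧)
        ≡⟨ sumL-cong (allSubsets n) pointwise ⟩
      Σˢ (λ z → 2 * ⟦ member z ⟧ N.+ ⟦ spuriousᶻ z ⟧ N.+ ⟦ absent z ⟧)
        ≡⟨ sumL-+₃ (allSubsets n) _ _ _ ⟩
      Σˢ (λ z → 2 * ⟦ member z ⟧) N.+ Σˢ (λ z → ⟦ spuriousᶻ z ⟧) N.+ Σˢ (λ z → ⟦ absent z ⟧)
        ≡⟨ cong₂ N._+_ (cong₂ N._+_ (trans (sumL-* (allSubsets n) 2 _) (cong (2 *_) (sym (card-sum member))))
                         (sym (card-sum spuriousᶻ))) (sym (card-sum absent)) ⟩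
      2 * card member N.+ card spuriousᶻ N.+ card absent ∎
      where
      open ≡-Reasoning
      boolean : ∀ e h u → (e ≡ true → h ≡ true) →
        1 N.+ ⟦ e ∧ not u ⟧ N.+ ⟦ e ∧ u ⟧ ≡ 2 * ⟦ e ⟧ N.+ ⟦ not e ∧ h ⟧ N.+ ⟦ not h ⟧
      boolean true  true  true  _ = refl
      boolean true  true  false _ = refl
      boolean true  false _     e⇒h with () ← e⇒h refl
      boolean false true  _     _ = refl
      boolean false false _     _ = refl
      pointwise : ∀ z → ⟦ R z ⟧ N.+ ⟦ pureᶻ z ⟧ N.+ ⟦ removable z ⟧ ≡
                        2 * ⟦ member z ⟧ N.+ ⟦ spuriousᶻ z ⟧ N.+ ⟦ absent z ⟧
      pointwise z with R z in Rz
      ... | false = refl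
      ... | true = boolean (a ∈ᵇ z) (a ∈ᵇ φ z) (U (del (φ z) a))
                     (λ t → ∈⇒∈ᵇ {a = a} (extensive z (∧-trueˡ Rz) (∈ᵇ⇒∈ {a = a} t)))

    -- Shifting along a inside the up-set φ(F[S]).
    absent≡droppable : card absent ≡ card droppable
    absent≡droppable = begin
      card absent                                              ≡⟨ sym (card-transfer R (λ η → not (a ∈ᵇ η)) φ R-injective) ⟩
      card (λ η → V η ∧ not (a ∈ᵇ η))                          ≡⟨ shift-count V a (V-raised a) ⟩
      card (λ η → V η ∧ ((a ∈ᵇ η) ∧ V (del η a)))              ≡⟨ card-transfer R (λ η → (a ∈ᵇ η) ∧ V (del η a)) φ R-injective ⟩
      card droppable                                           ∎
      where open ≡-Reasoning

    -- If φ z ∖ {a} ∈ φ(F[S]) ⊆ φ(F), then a is not spurious for z, so a ∈ z.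
    droppable⇒removable : ∀ z → droppable z ≡ true → removable z ≡ true
    droppable⇒removable z t = ∧-true⁺ Rz (∧-true⁺ a∈z U-del)
      where
      Rz : R z ≡ true
      Rz = ∧-trueˡ t
      a∈φz : (a ∈ᵇ φ z) ≡ true
      a∈φz = ∧-trueˡ (∧-trueʳ {R z} t)
      U-del : U (del (φ z) a) ≡ true
      U-del = ∧-trueˡ (trans (sym (V-char (del (φ z) a))) (∧-trueʳ {a ∈ᵇ φ z} (∧-trueʳ {R z} t)))
      a∈z : (a ∈ᵇ z) ≡ true
      a∈z with a ∈ᵇ z in e
      ... | true = refl
      ... | false with () ← trans (sym U-del)
              (spurious-essential z a (∧-trueˡ Rz) (λ a∈ → BoolP.not-¬ e (∈⇒∈ᵇ a∈)) (∈ᵇ⇒∈ a∈φz))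

    letter-bound : card R N.+ card pureᶻ N.≤ 2 * card member N.+ card spuriousᶻ
    letter-bound = cancel-≤ balance (subst (N._≤ card removable) (sym absent≡droppable) (card-mono droppable⇒removable))

    -- When every member of F lies in S↑, φ(F[S]) = φ(F) and the two counts agree.
    removable⇒droppable : (∀ f → F f ≡ true → upset S f ≡ true) → ∀ z → removable z ≡ true → droppable z ≡ true
    removable⇒droppable covered z t = ∧-true⁺ Rz (∧-true⁺ a∈φz (image-covered covered _ U-del))
      where
      Rz : R z ≡ true
      Rz = ∧-trueˡ t
      U-del : U (del (φ z) a) ≡ true
      U-del = ∧-trueʳ {a ∈ᵇ z} (∧-trueʳ {R z} t)
      a∈φz : (a ∈ᵇ φ z) ≡ true
      a∈φz = ∈⇒∈ᵇ {a = a} (extensive z (∧-trueˡ Rz) (∈ᵇ⇒∈ {a = a} (∧-trueˡ (∧-trueʳ {R z} t))))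

    letter-exact : (∀ f → F f ≡ true → upset S f ≡ true) →
      card R N.+ card pureᶻ ≡ 2 * card member N.+ card spuriousᶻ
    letter-exact covered = cancel-≡ balance (trans
      (NP.≤-antisym (card-mono (removable⇒droppable covered)) (card-mono droppable⇒removable))
      (sym absent≡droppable))

  open Letter using (member; pureᶻ; spuriousᶻ)

  pureTotal spuriousTotal : ℕ
  pureTotal = Σᵉ (λ a → card (pure F a ∩ᶠ upset S))
  spuriousTotal = Σᵉ (λ a → card (spurious F a ∩ᶠ upset S))

  size-sum : sumOver R FS.∣_∣ ≡ Σᵉ (λ a → card (member a))
  size-sum = begin
    Σˢ (λ z → if R z then FS.∣ z ∣ else 0)         ≡⟨ sumL-cong (allSubsets n) by-letters ⟩
    Σˢ (λ z → Σᵉ (λ a → ⟦ member a z ⟧))           ≡⟨ sumL-swap (allSubsets n) (allFin n) _ ⟩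
    Σᵉ (λ a → Σˢ (λ z → ⟦ member a z ⟧))           ≡⟨ sumL-cong (allFin n) (λ a → sym (card-sum (member a))) ⟩
    Σᵉ (λ a → card (member a))                     ∎
    where
    open ≡-Reasoning
    by-letters : ∀ z → (if R z then FS.∣ z ∣ else 0) ≡ Σᵉ (λ a → ⟦ member a z ⟧)
    by-letters z with R z
    ... | true = size-as-count z
    ... | false = sym (sumL-zero (allFin n) (λ _ → refl))

  left-total : Σᵉ (λ a → card R N.+ card (pureᶻ a)) ≡ n * card R N.+ pureTotal
  left-total = trans (sumL-+ (allFin n) _ _)
    (cong₂ N._+_ (Σᵉ-const {n} (card R)) (sumL-cong (allFin n) (λ a → sym (Letter.pure-count a))))

  right-total : Σᵉ (λ a → 2 * card (member a) N.+ card (spuriousᶻ a)) ≡ 2 * sumOver R FS.∣_∣ N.+ spuriousTotal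
  right-total = trans (sumL-+ (allFin n) _ _)
    (cong₂ N._+_ (trans (sumL-* (allFin n) 2 _) (cong (2 *_) (sym size-sum)))
                 (sumL-cong (allFin n) (λ a → sym (Letter.spurious-count a))))

  inequality : n * card R N.+ pureTotal N.≤ 2 * sumOver R FS.∣_∣ N.+ spuriousTotal
  inequality = subst₂ N._≤_ left-total right-total (sumL-mono (allFin n) Letter.letter-bound)

  equality : (∀ f → F f ≡ true → upset S f ≡ true) →
    n * card R N.+ pureTotal ≡ 2 * sumOver R FS.∣_∣ N.+ spuriousTotal
  equality covered = trans (sym left-total)
    (trans (sumL-cong (allFin n) (λ a → Letter.letter-exact a covered)) right-total)

sumℤ-differences : ∀ {A : Set} (xs : List A) (p s : A → ℕ) →
  sumℤ (L.map (λ a → + p a - + s a) xs) ≡ + sumL xs p - + sumL xs s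
sumℤ-differences [] p s = refl
sumℤ-differences (x ∷ xs) p s = begin
  (+ p x - + s x) + sumℤ (L.map (λ a → + p a - + s a) xs) ≡⟨ cong (λ t → (+ p x - + s x) + t) (sumℤ-differences xs p s) ⟩
  (+ p x - + s x) + (+ sumL xs p - + sumL xs s)          ≡⟨ regroup (+ p x) (+ s x) (+ sumL xs p) (+ sumL xs s) ⟩
  (+ p x + + sumL xs p) - (+ s x + + sumL xs s)          ≡⟨ sym (cong₂ _-_ (ℤP.pos-+ (p x) (sumL xs p)) (ℤP.pos-+ (s x) (sumL xs s))) ⟩
  + sumL (x ∷ xs) p - + sumL (x ∷ xs) s                  ∎
  where
  open ≡-Reasoning
  regroup : ∀ (a b c d : ℤ) → (a - b) + (c - d) ≡ (a + c) - (b + d)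
  regroup = solve-∀

shift-difference : ∀ (x p : ℕ) (s : ℤ) → + x + (+ p - s) ≡ + (x N.+ p) - s
shift-difference x p s = trans (assoc (+ x) (+ p) s) (cong (_- s) (sym (ℤP.pos-+ x p)))
  where
  assoc : ∀ (a b c : ℤ) → a + (b - c) ≡ (a + b) - c
  assoc = solve-∀

add-sub : ∀ (y s : ℕ) → + y ≡ + (y N.+ s) - + s
add-sub y s = trans (cancel (+ y) (+ s)) (cong (_- + s) (sym (ℤP.pos-+ y s)))
  where
  cancel : ∀ (a b : ℤ) → a ≡ (a + b) - b
  cancel = solve-∀

ℤ-bound : ∀ x p y s → x N.+ p N.≤ y N.+ s → + x + (+ p - + s) ≤ + y
ℤ-bound x p y s le = subst₂ _≤_ (sym (shift-difference x p (+ s))) (sym (add-sub y s))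
  (ℤP.+-monoˡ-≤ (Data.Integer.- (+ s)) (Data.Integer.+≤+ le))

ℤ-exact : ∀ x p y s → x N.+ p ≡ y N.+ s → + y ≡ + x + (+ p - + s)
ℤ-exact x p y s eq = trans (add-sub y s) (trans (cong (λ m → + m - + s) (sym eq)) (sym (shift-difference x p (+ s))))

proposition5p9 : (n : ℕ) (F S : Fam n) → UnionClosed F → CoversX F →
    SubFamily S F → Antichain S →
    (+ (n * card (restrictTo F S)) + pureSpuriousSum F S
        ≤ + (2 * sumOver (restrictTo F S) Data.Fin.Subset.∣_∣))
    × ((∀ (z : Subset n) → S z ≡ minFam F z) →
        + (2 * sumOver (restrictTo F S) Data.Fin.Subset.∣_∣)
          ≡ + (n * card (restrictTo F S)) + pureSpuriousSum F S)
proposition5p9 n F S uc _ S⊆F _ =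
  subst (λ d → + (n * card R) + d ≤ + (2 * sumOver R FS.∣_∣)) (sym differences)
    (ℤ-bound (n * card R) pureTotal (2 * sumOver R FS.∣_∣) spuriousTotal inequality)
  , λ S≡min → subst (λ d → + (2 * sumOver R FS.∣_∣) ≡ + (n * card R) + d) (sym differences)
    (ℤ-exact (n * card R) pureTotal (2 * sumOver R FS.∣_∣) spuriousTotal (equality (covered S≡min)))
  where
  open Counting F S uc S⊆F

  differences : pureSpuriousSum F S ≡ + pureTotal - + spuriousTotal
  differences = sumℤ-differences (allFin n) _ _

  covered : (∀ z → S z ≡ minFam F z) → ∀ f → F f ≡ true → upset S f ≡ true
  covered S≡min f Ff with minimal-below F Ff
  ... | m , m-min , m⊆f = upset-intro S (trans (S≡min m) m-min) m⊆f
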